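{- Let $G$ be a finite simple graph, $k\geq 0$, and let $Z\subseteq ET_{k,k}(G)$ be the set of eulerian $k$-trails $\bar{x}$ of length $k$ with $\partial_{k,k}(\bar{x})=0$. Then \[c(G,\Delta_{k+1})\leq\left\lfloor\frac{|Z|}{(k+1)!}\right\rfloor,\] where $\Delta_{k+1}$ is the complete graph on $k+1$ vertices.
   Context: For graphs $G=(V,E)$ and $H$, $c(G,H)=|\{W\subseteq V: G\vert_W\cong H\}|$, where $G\vert_W$ is the full (induced) subgraph on $W$. With path metric $d$, a $k$-trail is $(x_0,\dots,x_k)\in V^{k+1}$ with $x_i\neq x_{i+1}$, $d(x_i,x_{i+1})<\infty$; its length is $\sum_i d(x_i,x_{i+1})$; it is eulerian if all entries are distinct. $ET_{k,\ell}(G)$ is the set of eulerian $k$-trails of length $\ell$; $EMC_{k,\ell}(G)$ is the free abelian group on it, with differential $\partial_{k,\ell}=\sum_{i=1}^{k-1}(-1)^i\partial^i_{k,\ell}$, where $\partial^i_{k,\ell}(x_0,\dots,x_k)=(x_0,\dots,\widehat{x_i},\dots,x_k)$ if this tuple has length $\ell$ and $0$ otherwise. -}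

module Defs where

open import Data.Nat using (ℕ; zero; suc; _+_; _≤_; _/_; _!; _∸_)
open import Data.Nat.Properties using (_!≢0)
open import Data.Bool using (Bool; true; false; _∧_; _∨_; not; if_then_else_)
open import Data.Fin using (Fin; toℕ)
open import Data.Fin.Properties using (_≟_)
open import Data.Vec as V using (Vec; []; _∷_)
open import Data.Bool.ListAction using (any; all)
open import Data.List as L using (List; []; _∷_; [_]; length; filterᵇ; concatMap; allFin)
open import Data.Maybe using (Maybe; just; nothing)
open import Data.Integer as ℤ using (ℤ; 0ℤ)
import Data.Integer.Properties as ℤP
open import Relation.Nullary.Decidable using (⌊_⌋)
open import Relation.Nullary using (yes; no)
open import Data.Empty using (⊥-elim)
import Data.Nat
open import Relation.Binary.PropositionalEquality using (_≡_; refl)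
import Relation.Binary.PropositionalEquality

record Graph : Set where
  field
    n      : ℕ
    adj    : Fin n → Fin n → Bool
    irrefl : ∀ x → adj x x ≡ false
    sym    : ∀ x y → adj x y ≡ adj y x

Δ : ℕ → Graph
Δ m = record { n = m ; adj = λ i j → not ⌊ i ≟ j ⌋ ; irrefl = irr ; sym = sy }
  where
  irr : ∀ x → not ⌊ x ≟ x ⌋ ≡ false
  irr x with x ≟ x
  ... | yes _ = refl
  ... | no ¬p = ⊥-elim (¬p refl)
  sy : ∀ x y → not ⌊ x ≟ y ⌋ ≡ not ⌊ y ≟ x ⌋
  sy x y with x ≟ y | y ≟ x
  ... | yes _ | yes _ = refl
  ... | no _  | no _  = refl
  ... | yes p | no q  = ⊥-elim (q (Relation.Binary.PropositionalEquality.sym p))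
  ... | no p  | yes q = ⊥-elim (p (Relation.Binary.PropositionalEquality.sym q))

vecs : {A : Set} → List A → (m : ℕ) → List (Vec A m)
vecs xs zero    = [ [] ]
vecs xs (suc m) = concatMap (λ x → L.map (x ∷_) (vecs xs m)) xs

count : {A : Set} → (A → Bool) → List A → ℕ
count p xs = length (filterᵇ p xs)

eqF : {n : ℕ} → Fin n → Fin n → Bool
eqF x y = ⌊ x ≟ y ⌋

eqVec : {n m : ℕ} → Vec (Fin n) m → Vec (Fin n) m → Bool
eqVec []       []       = true
eqVec (x ∷ xs) (y ∷ ys) = eqF x y ∧ eqVec xs ys

elemF : {n m : ℕ} → Fin n → Vec (Fin n) m → Bool
elemF x v = any (eqF x) (V.toList v)

distinct : {n : ℕ} → List (Fin n) → Bool
distinct []       = true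
distinct (x ∷ xs) = not (any (eqF x) xs) ∧ distinct xs

module _ (G : Graph) where
  open Graph G

  vertices : List (Fin n)
  vertices = allFin n

  -- subsets W ⊆ V as characteristic vectors
  subsets : List (Vec Bool n)
  subsets = vecs (true ∷ false ∷ []) n

  -- G|W ≅ H : some injective f : V(H) → V(G) with image exactly W
  -- that preserves and reflects adjacency
  inducedIso : (H : Graph) → Vec Bool n → Bool
  inducedIso H W =
    any (λ f → distinct (V.toList f)
             ∧ all (λ v → V.lookup W v ⇔ᵇ elemF v f) vertices
             ∧ all (λ i → all (λ j → adj (V.lookup f i) (V.lookup f j) ⇔ᵇ Graph.adj H i j)
                              (allFin (Graph.n H)))
                   (allFin (Graph.n H)))
        (vecs vertices (Graph.n H))
    where
    _⇔ᵇ_ : Bool → Bool → Bool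
    a ⇔ᵇ b = (a ∧ b) ∨ (not a ∧ not b)

  c : Graph → ℕ
  c H = count (inducedIso H) subsets

  reach : ℕ → Fin n → Fin n → Bool
  reach zero    x y = eqF x y
  reach (suc m) x y = reach m x y ∨ any (λ z → reach m x z ∧ adj z y) vertices

  least : (ℕ → Bool) → ℕ → ℕ → Maybe ℕ
  least p from zero       = nothing
  least p from (suc fuel) = if p from then just from else least p (suc from) fuel

  -- path metric d(x,y); nothing = ∞.  (A shortest walk has length < n.)
  d : Fin n → Fin n → Maybe ℕ
  d x y = least (λ m → reach m x y) 0 n

  _+ᴹ_ : Maybe ℕ → Maybe ℕ → Maybe ℕ
  just a +ᴹ just b = just (a + b)
  _      +ᴹ _      = nothing

  len : List (Fin n) → Maybe ℕ
  len []           = just 0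
  len (x ∷ [])     = just 0
  len (x ∷ y ∷ xs) = d x y +ᴹ len (y ∷ xs)

  eqMℕ : Maybe ℕ → ℕ → Bool
  eqMℕ (just a) b = ⌊ a Data.Nat.≟ b ⌋
  eqMℕ nothing  b = false

  consecDistinct : List (Fin n) → Bool
  consecDistinct []           = true
  consecDistinct (x ∷ [])     = true
  consecDistinct (x ∷ y ∷ xs) = not (eqF x y) ∧ consecDistinct (y ∷ xs)

  hasLength : List (Fin n) → ℕ → Bool
  hasLength xs ℓ = eqMℕ (len xs) ℓ

  isET : (k ℓ : ℕ) → Vec (Fin n) (suc k) → Bool
  isET k ℓ x = consecDistinct (V.toList x) ∧ distinct (V.toList x) ∧ hasLength (V.toList x) ℓ

  sign : ℕ → ℤ
  sign zero          = ℤ.+ 1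
  sign (suc zero)    = ℤ.- (ℤ.+ 1)
  sign (suc (suc i)) = sign i

  -- ∂_{k,ℓ}(x̄) ∈ EMC_{k-1,ℓ}(G), given by its coefficient at each tuple y:
  -- ∑_{i=1}^{k-1} (-1)^i [∂ⁱ x̄ has length ℓ] [∂ⁱ x̄ = y]
  ∂coeff : (k ℓ : ℕ) → Vec (Fin n) (suc k) → Vec (Fin n) k → ℤ
  ∂coeff k ℓ x y =
    L.foldr ℤ._+_ 0ℤ
      (L.map (λ i → let xi = V.removeAt x i in
                    if (1 Data.Nat.≤ᵇ toℕ i) ∧ (toℕ i Data.Nat.<ᵇ k)
                       ∧ hasLength (V.toList xi) ℓ ∧ eqVec xi y
                    then sign (toℕ i) else 0ℤ)
             (allFin (suc k)))

  ∂zero : (k ℓ : ℕ) → Vec (Fin n) (suc k) → Bool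
  ∂zero k ℓ x = all (λ y → ⌊ ∂coeff k ℓ x y ℤ.≟ 0ℤ ⌋) (vecs vertices k)

  sizeZ : ℕ → ℕ
  sizeZ k = count (λ x → isET k k x ∧ ∂zero k k x) (vecs vertices (suc k))

-- The orderings of a (k+1)-clique W are (k+1)! eulerian k-trails: consecutive
-- vertices are adjacent, so such a trail has length k, while deleting an interior
-- vertex leaves a tuple of length k-1, so every face ∂ⁱ is discarded and ∂ vanishes.
-- A trail determines its vertex set, so different cliques contribute disjoint sets
-- of trails to Z; double counting over vertex sets gives (k+1)! c(G,Δ_{k+1}) ≤ |Z|.

module Submission where

open import Data.Bool using (Bool; true; false; _∧_; _∨_; not; T; if_then_else_)
open import Data.Bool.ListAction using (any; all)
import Data.Bool.Properties as Bool
open import Algebra.Solver.CommutativeMonoid Bool.∧-commutativeMonoid using (solve; _⊕_; _⊜_)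
open import Data.Empty using (⊥-elim)
open import Data.Fin using (Fin; zero; suc; toℕ)
import Data.Fin.Properties as Fin
open import Data.Integer as ℤ using (ℤ; 0ℤ)
open import Data.List as L using (List; []; _∷_; _++_; length; map; concatMap; filterᵇ)
open import Data.List.Membership.Propositional using (_∈_; lose)
open import Data.List.Membership.Propositional.Properties using (∈-allFin)
open import Data.List.Properties using (length-++; filter-++; map-cong)
open import Data.List.Relation.Unary.All as All using (All; []; _∷_)
open import Data.List.Relation.Unary.All.Properties using (all⁺; all⁻)
open import Data.List.Relation.Unary.Any as Any using (here; there; satisfied)
open import Data.List.Relation.Unary.Any.Properties using (any⁺; any⁻)
open import Data.List.Relation.Unary.Unique.Propositional using (Unique; []; _∷_)
open import Data.List.Relation.Unary.Unique.Propositional.Properties using (allFin⁺)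
open import Data.Maybe using (just)
open import Data.Nat
  using (ℕ; zero; suc; pred; _+_; _*_; _≤_; _<_; _≤ᵇ_; _<ᵇ_; z≤n; s≤s; _!; _/_; NonZero)
open import Data.Nat.DivMod using (m*n/n≡m; /-monoˡ-≤)
open import Data.Nat.ListAction using (sum)
open import Data.Nat.Properties
open import Algebra.Properties.CommutativeSemigroup +-commutativeSemigroup
  using () renaming (interchange to +-interchange)
open import Data.Product using (_×_; _,_; proj₁; proj₂; ∃)
open import Data.Sum using (inj₂)
open import Data.Vec as V using (Vec; []; _∷_)
import Data.Vec.Properties as V
open import Data.Vec.Membership.Propositional.Properties using (∈-toList⁻)
import Data.Vec.Relation.Unary.Any as VAny
open import Data.Vec.Relation.Unary.Any.Properties using (lookup-index)
open import Defs
open import Function using (_∘_)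
open import Function.Bundles using (Equivalence)
open import Relation.Binary.Definitions using (DecidableEquality)
open import Relation.Binary.PropositionalEquality hiding ([_])
open import Relation.Nullary using (¬_; yes; no; contradiction)
open import Relation.Nullary.Decidable using (⌊_⌋; T?; toWitness; fromWitness; fromWitnessFalse)

private variable
  A B : Set

[_] : Bool → ℕ
[ true ]  = 1
[ false ] = 0

[]-true : ∀ {b} → T b → [ b ] ≡ 1
[]-true {true} _ = refl

[]-false : ∀ {b} → ¬ T b → [ b ] ≡ 0
[]-false {false} _  = refl
[]-false {true}  ¬b = ⊥-elim (¬b _)

[]-mono-≤ : ∀ {a b} → (T a → T b) → [ a ] ≤ [ b ]
[]-mono-≤ {false}        _ = z≤n
[]-mono-≤ {true} {true}  _ = ≤-refl
[]-mono-≤ {true} {false} h = ⊥-elim (h _)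

[]-< : ∀ {a b} → ¬ T a → T b → [ a ] < [ b ]
[]-< {false} {true} _  _ = s≤s z≤n
[]-< {true}         ¬a _ = ⊥-elim (¬a _)

[]-split : ∀ {a b} → (T b → T a) → [ a ] ≡ [ b ] + [ a ∧ not b ]
[]-split {true}  {true}  _ = refl
[]-split {true}  {false} _ = refl
[]-split {false} {false} _ = refl
[]-split {false} {true}  h = ⊥-elim (h _)

[]-disjoint-∨ : ∀ {a b} → ¬ (T a × T b) → [ a ∨ b ] ≡ [ a ] + [ b ]
[]-disjoint-∨ {true}  {true}  ¬ab = ⊥-elim (¬ab (_ , _))
[]-disjoint-∨ {true}  {false} _   = refl
[]-disjoint-∨ {false}         _   = refl

T-∧⁻ : ∀ {a b} → T (a ∧ b) → T a × T b
T-∧⁻ = Equivalence.to Bool.T-∧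

T-∧⁺ : ∀ {a b} → T a × T b → T (a ∧ b)
T-∧⁺ = Equivalence.from Bool.T-∧

¬T-∧ˡ : ∀ {a b} → ¬ T a → ¬ T (a ∧ b)
¬T-∧ˡ {false} _  ()
¬T-∧ˡ {true}  ¬a = ⊥-elim (¬a _)

¬T-∧ʳ : ∀ a {b} → ¬ T b → ¬ T (a ∧ b)
¬T-∧ʳ false _  ()
¬T-∧ʳ true  ¬b = ¬b

T-not⁻ : ∀ {a} → T (not a) → ¬ T a
T-not⁻ {false} _ ()

T-injective : ∀ {a b} → (T a → T b) → (T b → T a) → a ≡ b
T-injective {false} {false} _ _ = refl
T-injective {false} {true}  _ h = ⊥-elim (h _)
T-injective {true}  {false} h _ = ⊥-elim (h _)
T-injective {true}  {true}  _ _ = refl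

_⇔ᵇ_ : Bool → Bool → Bool
a ⇔ᵇ b = (a ∧ b) ∨ (not a ∧ not b)

T-⇔ᵇ⁻ : ∀ a b → T (a ⇔ᵇ b) → a ≡ b
T-⇔ᵇ⁻ false false _ = refl
T-⇔ᵇ⁻ true  true  _ = refl

deMorgan₂ : ∀ a b → not (a ∨ b) ≡ not a ∧ not b
deMorgan₂ false _ = refl
deMorgan₂ true  _ = refl

if-¬T : ∀ {c} {t e : A} → ¬ T c → (if c then t else e) ≡ e
if-¬T {c = false} _  = refl
if-¬T {c = true}  ¬c = ⊥-elim (¬c _)

⌊≟⌋-sym : ∀ (_≟_ : DecidableEquality A) x y → ⌊ x ≟ y ⌋ ≡ ⌊ y ≟ x ⌋
⌊≟⌋-sym _≟_ x y = T-injective (fromWitness ∘ sym ∘ toWitness) (fromWitness ∘ sym ∘ toWitness)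

⌊≡-dec-∷⌋ : ∀ (_≟_ : DecidableEquality A) {n} a x (v u : Vec A n) →
            ⌊ V.≡-dec _≟_ (a ∷ v) (x ∷ u) ⌋ ≡ ⌊ a ≟ x ⌋ ∧ ⌊ V.≡-dec _≟_ v u ⌋
⌊≡-dec-∷⌋ _≟_ a x v u with a ≟ x | V.≡-dec _≟_ v u
... | yes _ | yes _ = refl
... | yes _ | no _  = refl
... | no _  | _     = refl

∑ : (A → ℕ) → List A → ℕ
∑ f xs = sum (map f xs)

∑-cong : ∀ {f g : A → ℕ} → (∀ x → f x ≡ g x) → ∀ xs → ∑ f xs ≡ ∑ g xs
∑-cong f≗g xs = cong sum (map-cong f≗g xs)

∑-mono-≤ : ∀ {f g : A → ℕ} → (∀ x → f x ≤ g x) → ∀ xs → ∑ f xs ≤ ∑ g xs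
∑-mono-≤ f≤g []       = z≤n
∑-mono-≤ f≤g (x ∷ xs) = +-mono-≤ (f≤g x) (∑-mono-≤ f≤g xs)

∑-zero : ∀ (xs : List A) → ∑ (λ _ → 0) xs ≡ 0
∑-zero []       = refl
∑-zero (x ∷ xs) = ∑-zero xs

∑-distrib-+ : ∀ (f g : A → ℕ) xs → ∑ (λ x → f x + g x) xs ≡ ∑ f xs + ∑ g xs
∑-distrib-+ f g []       = refl
∑-distrib-+ f g (x ∷ xs) =
  trans (cong (f x + g x +_) (∑-distrib-+ f g xs)) (+-interchange (f x) (g x) (∑ f xs) (∑ g xs))

∑-distribʳ-* : ∀ (f : A → ℕ) c xs → ∑ (λ x → f x * c) xs ≡ ∑ f xs * c
∑-distribʳ-* f c []       = refl
∑-distribʳ-* f c (x ∷ xs) =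
  trans (cong (f x * c +_) (∑-distribʳ-* f c xs)) (sym (*-distribʳ-+ c (f x) (∑ f xs)))

foldr-+-zeros : ∀ (h : A → ℤ) → (∀ x → h x ≡ 0ℤ) → ∀ xs → L.foldr ℤ._+_ 0ℤ (map h xs) ≡ 0ℤ
foldr-+-zeros h h≗0 []       = refl
foldr-+-zeros h h≗0 (x ∷ xs) = cong₂ ℤ._+_ (h≗0 x) (foldr-+-zeros h h≗0 xs)

count-∷ : ∀ (p : A → Bool) x xs → count p (x ∷ xs) ≡ [ p x ] + count p xs
count-∷ p x xs with p x
... | true  = refl
... | false = refl

count≡∑ : ∀ (p : A → Bool) xs → count p xs ≡ ∑ (λ x → [ p x ]) xs
count≡∑ p []       = refl
count≡∑ p (x ∷ xs) = trans (count-∷ p x xs) (cong ([ p x ] +_) (count≡∑ p xs))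

count-++ : ∀ (p : A → Bool) xs ys → count p (xs ++ ys) ≡ count p xs + count p ys
count-++ p xs ys = trans (cong length (filter-++ (T? ∘ p) xs ys)) (length-++ (filterᵇ p xs))

count-none : ∀ (p : A → Bool) {xs} → All (¬_ ∘ T ∘ p) xs → count p xs ≡ 0
count-none p {[]}     []           = refl
count-none p {x ∷ xs} (¬px ∷ ¬pxs) with p x
... | false = count-none p ¬pxs
... | true  = ⊥-elim (¬px _)

count-+ : ∀ {p q r : A → Bool} → (∀ x → [ p x ] ≡ [ q x ] + [ r x ]) →
          ∀ xs → count p xs ≡ count q xs + count r xs
count-+ {p = p} {q} {r} split xs = begin
  count p xs                                   ≡⟨ count≡∑ p xs ⟩
  ∑ (λ x → [ p x ]) xs                         ≡⟨ ∑-cong split xs ⟩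
  ∑ (λ x → [ q x ] + [ r x ]) xs               ≡⟨ ∑-distrib-+ _ _ xs ⟩
  ∑ (λ x → [ q x ]) xs + ∑ (λ x → [ r x ]) xs  ≡⟨ cong₂ _+_ (count≡∑ q xs) (count≡∑ r xs) ⟨
  count q xs + count r xs                      ∎
  where open ≡-Reasoning

count-cong : ∀ {p q : A → Bool} → (∀ x → p x ≡ q x) → ∀ xs → count p xs ≡ count q xs
count-cong {p = p} {q} p≗q xs = begin
  count p xs            ≡⟨ count≡∑ p xs ⟩
  ∑ (λ x → [ p x ]) xs  ≡⟨ ∑-cong (cong [_] ∘ p≗q) xs ⟩
  ∑ (λ x → [ q x ]) xs  ≡⟨ count≡∑ q xs ⟨
  count q xs            ∎
  where open ≡-Reasoning

count-mono-≤ : ∀ {p q : A → Bool} → (∀ x → T (p x) → T (q x)) → ∀ xs → count p xs ≤ count q xs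
count-mono-≤ {p = p} {q} p⇒q xs = begin
  count p xs            ≡⟨ count≡∑ p xs ⟩
  ∑ (λ x → [ p x ]) xs  ≤⟨ ∑-mono-≤ ([]-mono-≤ ∘ p⇒q) xs ⟩
  ∑ (λ x → [ q x ]) xs  ≡⟨ count≡∑ q xs ⟨
  count q xs            ∎
  where open ≤-Reasoning

count-mono-< : ∀ {p q : A → Bool} → (∀ x → T (p x) → T (q x)) →
               ∀ {x xs} → x ∈ xs → ¬ T (p x) → T (q x) → count p xs < count q xs
count-mono-< {p = p} {q} p⇒q {x} {_ ∷ xs} (here refl) ¬px qx = begin-strict
  count p (x ∷ xs)      ≡⟨ count-∷ p x xs ⟩
  [ p x ] + count p xs  <⟨ +-mono-<-≤ ([]-< ¬px qx) (count-mono-≤ p⇒q xs) ⟩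
  [ q x ] + count q xs  ≡⟨ count-∷ q x xs ⟨
  count q (x ∷ xs)      ∎
  where open ≤-Reasoning
count-mono-< {p = p} {q} p⇒q {xs = y ∷ xs} (there x∈xs) ¬px qx = begin-strict
  count p (y ∷ xs)      ≡⟨ count-∷ p y xs ⟩
  [ p y ] + count p xs  <⟨ +-mono-≤-< ([]-mono-≤ (p⇒q y)) (count-mono-< p⇒q x∈xs ¬px qx) ⟩
  [ q y ] + count q xs  ≡⟨ count-∷ q y xs ⟨
  count q (y ∷ xs)      ∎
  where open ≤-Reasoning

count-≡⇒⊇ : ∀ {p q : A → Bool} → (∀ x → T (p x) → T (q x)) →
            ∀ {xs} → count p xs ≡ count q xs → ∀ {x} → x ∈ xs → T (q x) → T (p x)
count-≡⇒⊇ {p = p} p⇒q eq {x} x∈xs qx with T? (p x)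
... | yes px = px
... | no ¬px = contradiction eq (<⇒≢ (count-mono-< p⇒q x∈xs ¬px qx))

count-const-∧ : ∀ b (p : A → Bool) xs → count (λ x → b ∧ p x) xs ≡ [ b ] * count p xs
count-const-∧ true  p xs = sym (+-identityʳ (count p xs))
count-const-∧ false p xs = count-none (λ _ → false) (All.universal (λ _ ()) xs)

count-map : ∀ (p : B → Bool) (f : A → B) xs → count p (map f xs) ≡ count (p ∘ f) xs
count-map p f []       = refl
count-map p f (x ∷ xs) = begin
  count p (f x ∷ map f xs)          ≡⟨ count-∷ p (f x) (map f xs) ⟩
  [ p (f x) ] + count p (map f xs)  ≡⟨ cong ([ p (f x) ] +_) (count-map p f xs) ⟩
  [ p (f x) ] + count (p ∘ f) xs    ≡⟨ count-∷ (p ∘ f) x xs ⟨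
  count (p ∘ f) (x ∷ xs)            ∎
  where open ≡-Reasoning

count-concatMap : ∀ (p : B → Bool) (f : A → List B) xs →
                  count p (concatMap f xs) ≡ ∑ (count p ∘ f) xs
count-concatMap p f []       = refl
count-concatMap p f (x ∷ xs) =
  trans (count-++ p (f x) (concatMap f xs)) (cong (count p (f x) +_) (count-concatMap p f xs))

∑-count-comm : ∀ (p : B → A → Bool) xs ys →
               ∑ (λ y → count (p y) xs) ys ≡ ∑ (λ x → count (λ y → p y x) ys) xs
∑-count-comm p []       ys = ∑-zero ys
∑-count-comm p (x ∷ xs) ys = begin
  ∑ (λ y → count (p y) (x ∷ xs)) ys
    ≡⟨ ∑-cong (λ y → count-∷ (p y) x xs) ys ⟩
  ∑ (λ y → [ p y x ] + count (p y) xs) ys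
    ≡⟨ ∑-distrib-+ (λ y → [ p y x ]) (λ y → count (p y) xs) ys ⟩
  ∑ (λ y → [ p y x ]) ys + ∑ (λ y → count (p y) xs) ys
    ≡⟨ cong₂ _+_ (sym (count≡∑ (λ y → p y x) ys)) (∑-count-comm p xs ys) ⟩
  count (λ y → p y x) ys + ∑ (λ x → count (λ y → p y x) ys) xs
    ∎
  where open ≡-Reasoning

record Enumerates (_≟_ : DecidableEquality A) (xs : List A) : Set where
  field
    occurs-once : ∀ x → count (λ y → ⌊ x ≟ y ⌋) xs ≡ 1

open Enumerates

unique⇒enumerates : ∀ (_≟_ : DecidableEquality A) {xs} →
                    Unique xs → (∀ x → x ∈ xs) → Enumerates _≟_ xs
occurs-once (unique⇒enumerates _≟_ unique complete) x = once unique (complete x)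
  where
  once : ∀ {xs} → Unique xs → x ∈ xs → count (λ y → ⌊ x ≟ y ⌋) xs ≡ 1
  once {_ ∷ xs} (x∉xs ∷ _) (here refl) = trans (count-∷ (λ y → ⌊ x ≟ y ⌋) x xs) (cong₂ _+_
    ([]-true (fromWitness refl)) (count-none _ (All.map (λ x≢y → x≢y ∘ toWitness) x∉xs)))
  once {y ∷ xs} (y∉xs ∷ xs-unique) (there x∈xs) = trans (count-∷ (λ y → ⌊ x ≟ y ⌋) y xs) (cong₂ _+_
    ([]-false (All.lookup y∉xs x∈xs ∘ sym ∘ toWitness)) (once xs-unique x∈xs))

allFin-enumerates : ∀ n → Enumerates Fin._≟_ (L.allFin n)
allFin-enumerates n = unique⇒enumerates Fin._≟_ (allFin⁺ n) ∈-allFin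

Bool-enumerates : Enumerates Bool._≟_ (true ∷ false ∷ [])
occurs-once Bool-enumerates true  = refl
occurs-once Bool-enumerates false = refl

vecs-enumerates : ∀ {_≟_ : DecidableEquality A} {xs} → Enumerates _≟_ xs →
                  ∀ m → Enumerates (V.≡-dec _≟_) (vecs xs m)
occurs-once (vecs-enumerates xs-enum zero) [] = refl
occurs-once (vecs-enumerates {A = A} {_≟_} {xs} xs-enum (suc m)) (a ∷ v) = begin
  count (λ u → ⌊ (a ∷ v) ≟ᵥ u ⌋) (concatMap (λ x → map (x ∷_) (vecs xs m)) xs)
    ≡⟨ count-concatMap _ (λ x → map (x ∷_) (vecs xs m)) xs ⟩
  ∑ (λ x → count (λ u → ⌊ (a ∷ v) ≟ᵥ u ⌋) (map (x ∷_) (vecs xs m))) xs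
    ≡⟨ ∑-cong (λ x → trans (count-map _ (x ∷_) (vecs xs m))
                            (count-cong (⌊≡-dec-∷⌋ _≟_ a x v) (vecs xs m))) xs ⟩
  ∑ (λ x → count (λ u → ⌊ a ≟ x ⌋ ∧ ⌊ v ≟ᵥ u ⌋) (vecs xs m)) xs
    ≡⟨ ∑-cong (λ x → count-const-∧ ⌊ a ≟ x ⌋ _ (vecs xs m)) xs ⟩
  ∑ (λ x → [ ⌊ a ≟ x ⌋ ] * count (λ u → ⌊ v ≟ᵥ u ⌋) (vecs xs m)) xs
    ≡⟨ ∑-cong (λ x → cong ([ ⌊ a ≟ x ⌋ ] *_) (occurs-once (vecs-enumerates xs-enum m) v)) xs ⟩
  ∑ (λ x → [ ⌊ a ≟ x ⌋ ] * 1) xs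
    ≡⟨ ∑-distribʳ-* _ 1 xs ⟩
  ∑ (λ x → [ ⌊ a ≟ x ⌋ ]) xs * 1
    ≡⟨ cong (_* 1) (count≡∑ _ xs) ⟨
  count (λ x → ⌊ a ≟ x ⌋) xs * 1
    ≡⟨ cong (_* 1) (occurs-once xs-enum a) ⟩
  1 ∎
  where
  open ≡-Reasoning
  _≟ᵥ_ : ∀ {k} → DecidableEquality (Vec A k)
  _≟ᵥ_ = V.≡-dec _≟_

count-by-key : ∀ {_≟_ : DecidableEquality B} {ys} → Enumerates _≟_ ys →
               ∀ (key : A → B) (p : A → Bool) xs →
               count p xs ≡ ∑ (λ y → count (λ x → p x ∧ ⌊ key x ≟ y ⌋) xs) ys
count-by-key {_≟_ = _≟_} {ys} ys-enum key p xs = begin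
  count p xs
    ≡⟨ count≡∑ p xs ⟩
  ∑ (λ x → [ p x ]) xs
    ≡⟨ ∑-cong fibre xs ⟨
  ∑ (λ x → count (λ y → p x ∧ ⌊ key x ≟ y ⌋) ys) xs
    ≡⟨ ∑-count-comm (λ y x → p x ∧ ⌊ key x ≟ y ⌋) xs ys ⟨
  ∑ (λ y → count (λ x → p x ∧ ⌊ key x ≟ y ⌋) xs) ys ∎
  where
  open ≡-Reasoning
  fibre : ∀ x → count (λ y → p x ∧ ⌊ key x ≟ y ⌋) ys ≡ [ p x ]
  fibre x = begin
    count (λ y → p x ∧ ⌊ key x ≟ y ⌋) ys      ≡⟨ count-const-∧ (p x) _ ys ⟩
    [ p x ] * count (λ y → ⌊ key x ≟ y ⌋) ys  ≡⟨ cong ([ p x ] *_) (occurs-once ys-enum (key x)) ⟩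
    [ p x ] * 1                               ≡⟨ *-identityʳ _ ⟩
    [ p x ]                                   ∎

module _ {n : ℕ} where

  _─_ : (Fin n → Bool) → Fin n → (Fin n → Bool)
  (s ─ x) y = s y ∧ not ⌊ x Fin.≟ y ⌋

  distinctIn : (Fin n → Bool) → List (Fin n) → Bool
  distinctIn s l = distinct l ∧ all s l

  all-─ : ∀ s x l → all (s ─ x) l ≡ all s l ∧ not (any (λ y → ⌊ x Fin.≟ y ⌋) l)
  all-─ s x []      = refl
  all-─ s x (y ∷ l) = begin
    (s y ∧ not x≟y) ∧ all (s ─ x) l      ≡⟨ cong ((s ─ x) y ∧_) (all-─ s x l) ⟩
    (s y ∧ not x≟y) ∧ (all s l ∧ not a)  ≡⟨ solve 4 (λ b c d e → (b ⊕ c) ⊕ (d ⊕ e) ⊜ (b ⊕ d) ⊕ (c ⊕ e))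
                                                   refl (s y) (not x≟y) (all s l) (not a) ⟩
    (s y ∧ all s l) ∧ (not x≟y ∧ not a)  ≡⟨ cong ((s y ∧ all s l) ∧_) (deMorgan₂ x≟y a) ⟨
    (s y ∧ all s l) ∧ not (x≟y ∨ a)      ∎
    where
    open ≡-Reasoning
    x≟y = ⌊ x Fin.≟ y ⌋
    a   = any (λ y → ⌊ x Fin.≟ y ⌋) l

  distinctIn-∷ : ∀ s x l → distinctIn s (x ∷ l) ≡ s x ∧ distinctIn (s ─ x) l
  distinctIn-∷ s x l = begin
    (not a ∧ distinct l) ∧ (s x ∧ all s l)  ≡⟨ solve 4 (λ b c d e → (b ⊕ c) ⊕ (d ⊕ e) ⊜ d ⊕ (c ⊕ (e ⊕ b)))
                                                      refl (not a) (distinct l) (s x) (all s l) ⟩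
    s x ∧ (distinct l ∧ (all s l ∧ not a))  ≡⟨ cong (λ b → s x ∧ (distinct l ∧ b)) (all-─ s x l) ⟨
    s x ∧ distinctIn (s ─ x) l              ∎
    where
    open ≡-Reasoning
    a = any (λ y → ⌊ x Fin.≟ y ⌋) l

  distinctIn-∷⁻ : ∀ {s} x l → T (distinctIn s (x ∷ l)) → T (s x) × T (distinctIn (s ─ x) l)
  distinctIn-∷⁻ {s} x l = T-∧⁻ ∘ subst T (distinctIn-∷ s x l)

  distinctIn-∷⁺ : ∀ {s} x l → T (s x) → T (distinctIn (s ─ x) l) → T (distinctIn s (x ∷ l))
  distinctIn-∷⁺ {s} x l sx dl = subst T (sym (distinctIn-∷ s x l)) (T-∧⁺ (sx , dl))

  distinctIn-mono : ∀ {s t} → (∀ y → T (s y) → T (t y)) →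
                    ∀ l → T (distinctIn s l) → T (distinctIn t l)
  distinctIn-mono {s} {t} s⇒t l dl =
    let d , a = T-∧⁻ {distinct l} dl in T-∧⁺ (d , all⁻ t (All.map (s⇒t _) (all⁺ s l a)))

  ─⇒ : ∀ {s x} y → T ((s ─ x) y) → T (s y)
  ─⇒ _ = proj₁ ∘ T-∧⁻

  distinctIn-∷-∷⁻ : ∀ {s} x y l → T (distinctIn s (x ∷ y ∷ l)) →
                    T (s x) × T (s y) × x ≢ y × T (distinctIn s (y ∷ l))
  distinctIn-∷-∷⁻ {s} x y l dxyl =
    let sx , dyl      = distinctIn-∷⁻ x (y ∷ l) dxyl
        sy , x≢ᵇy     = T-∧⁻ (proj₁ (distinctIn-∷⁻ {s ─ x} y l dyl))
    in sx , sy , T-not⁻ x≢ᵇy ∘ fromWitness , distinctIn-mono (─⇒ {s}) (y ∷ l) dyl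

  distinctIn-removeAt : ∀ {s m} (g : Vec (Fin n) (suc m)) i →
                        T (distinctIn s (V.toList g)) → T (distinctIn s (V.toList (V.removeAt g i)))
  distinctIn-removeAt {s} (x ∷ g) zero dg =
    distinctIn-mono (─⇒ {s}) (V.toList g) (proj₂ (distinctIn-∷⁻ x (V.toList g) dg))
  distinctIn-removeAt {s} (x ∷ y ∷ g) (suc i) dg =
    let sx , dyg = distinctIn-∷⁻ x (V.toList (y ∷ g)) dg in
    distinctIn-∷⁺ x (V.toList (V.removeAt (y ∷ g) i)) sx (distinctIn-removeAt (y ∷ g) i dyg)

  count-─ : ∀ {xs} → Enumerates Fin._≟_ xs → ∀ {s x} → T (s x) → count s xs ≡ suc (count (s ─ x) xs)
  count-─ {xs} xs-enum {s} {x} sx = begin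
    count s xs
      ≡⟨ count-+ (λ y → []-split (x≡y⇒sy ∘ toWitness)) xs ⟩
    count (λ y → ⌊ x Fin.≟ y ⌋) xs + count (s ─ x) xs
      ≡⟨ cong (_+ count (s ─ x) xs) (occurs-once xs-enum x) ⟩
    suc (count (s ─ x) xs) ∎
    where
    open ≡-Reasoning
    x≡y⇒sy : ∀ {y} → x ≡ y → T (s y)
    x≡y⇒sy refl = sx

  count-arrangements : ∀ {xs} → Enumerates Fin._≟_ xs → ∀ m {s} → count s xs ≡ m →
                       count (λ g → distinctIn s (V.toList g)) (vecs xs m) ≡ m !
  count-arrangements xs-enum zero    _ = refl
  count-arrangements {xs} xs-enum (suc m) {s} |s|≡1+m = begin
    count (λ g → distinctIn s (V.toList g)) (concatMap (λ x → map (x ∷_) (vecs xs m)) xs)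
      ≡⟨ count-concatMap _ _ xs ⟩
    ∑ (λ x → count (λ g → distinctIn s (V.toList g)) (map (x ∷_) (vecs xs m))) xs
      ≡⟨ ∑-cong (λ x → trans (count-map _ (x ∷_) (vecs xs m))
                              (count-cong (λ g → distinctIn-∷ s x (V.toList g)) (vecs xs m))) xs ⟩
    ∑ (λ x → count (λ g → s x ∧ distinctIn (s ─ x) (V.toList g)) (vecs xs m)) xs
      ≡⟨ ∑-cong (λ x → count-const-∧ (s x) _ (vecs xs m)) xs ⟩
    ∑ (λ x → [ s x ] * count (λ g → distinctIn (s ─ x) (V.toList g)) (vecs xs m)) xs
      ≡⟨ ∑-cong continuations xs ⟩
    ∑ (λ x → [ s x ] * m !) xs
      ≡⟨ ∑-distribʳ-* _ (m !) xs ⟩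
    ∑ (λ x → [ s x ]) xs * m !
      ≡⟨ cong (_* m !) (trans (sym (count≡∑ s xs)) |s|≡1+m) ⟩
    suc m * m ! ∎
    where
    open ≡-Reasoning
    continuations : ∀ x → [ s x ] * count (λ g → distinctIn (s ─ x) (V.toList g)) (vecs xs m)
                        ≡ [ s x ] * m !
    continuations x with T? (s x)
    ... | yes sx = cong ([ s x ] *_) (count-arrangements xs-enum m
                                       (suc-injective (trans (sym (count-─ xs-enum sx)) |s|≡1+m)))
    ... | no ¬sx rewrite []-false ¬sx = refl

  elemF⇒∈ : ∀ {m v} {g : Vec (Fin n) m} → T (elemF v g) → v ∈ V.toList g
  elemF⇒∈ = Any.map toWitness ∘ any⁻ _ _

  elemF⇒lookup : ∀ {m v} {g : Vec (Fin n) m} → T (elemF v g) → ∃ λ i → V.lookup g i ≡ v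
  elemF⇒lookup {g = g} e =
    let v∈g = ∈-toList⁻ (elemF⇒∈ {g = g} e) in VAny.index v∈g , sym (lookup-index v∈g)

  count-elemF : ∀ {xs} → Enumerates Fin._≟_ xs → ∀ {m} (g : Vec (Fin n) m) →
                T (distinct (V.toList g)) → count (λ v → elemF v g) xs ≡ m
  count-elemF {xs} xs-enum []      _ = count-none _ (All.universal (λ _ ()) xs)
  count-elemF {xs} xs-enum {suc m} (x ∷ g) dxg with x∉g , dg ← T-∧⁻ dxg = begin
    count (λ v → ⌊ v Fin.≟ x ⌋ ∨ elemF v g) xs
      ≡⟨ count-+ (λ v → []-disjoint-∨ (disjoint v)) xs ⟩
    count (λ v → ⌊ v Fin.≟ x ⌋) xs + count (λ v → elemF v g) xs
      ≡⟨ cong₂ _+_ (trans (count-cong (λ v → ⌊≟⌋-sym Fin._≟_ v x) xs) (occurs-once xs-enum x))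
                   (count-elemF xs-enum g dg) ⟩
    suc m ∎
    where
    open ≡-Reasoning
    disjoint : ∀ v → ¬ (T ⌊ v Fin.≟ x ⌋ × T (elemF v g))
    disjoint v (v≡x , v∈g) with refl ← toWitness v≡x = T-not⁻ x∉g v∈g

  support : ∀ {m} → Vec (Fin n) m → Vec Bool n
  support g = V.tabulate (λ v → elemF v g)

  support-arrangement : ∀ {s m} {g : Vec (Fin n) m} → count s (L.allFin n) ≡ m →
                        T (distinctIn s (V.toList g)) → support g ≡ V.tabulate s
  support-arrangement {s} {g = g} |s|≡m dg with dg′ , g⊆s ← T-∧⁻ dg =
    V.tabulate-cong (λ v → T-injective (g⇒s v) (count-≡⇒⊇ g⇒s {L.allFin n} same-size (∈-allFin v)))
    where
    g⇒s : ∀ v → T (elemF v g) → T (s v)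
    g⇒s v = All.lookup (all⁺ s _ g⊆s) ∘ elemF⇒∈ {g = g}
    same-size : count (λ v → elemF v g) (L.allFin n) ≡ count s (L.allFin n)
    same-size = trans (count-elemF (allFin-enumerates n) g dg′) (sym |s|≡m)

≢⇒2≤ : ∀ {N} {x y : Fin N} → x ≢ y → 2 ≤ N
≢⇒2≤ {suc zero}    {zero} {zero} x≢y = ⊥-elim (x≢y refl)
≢⇒2≤ {suc (suc N)}                _   = s≤s (s≤s z≤n)

module _ (G : Graph) where
  open Graph G using (n; adj; irrefl)

  IsClique : (Fin n → Bool) → Set
  IsClique s = ∀ {u v} → T (s u) → T (s v) → u ≢ v → T (adj u v)

  least≡1 : ∀ (p : ℕ → Bool) {N} → ¬ T (p 0) → T (p 1) → 2 ≤ N → least G p 0 N ≡ just 1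
  least≡1 p {suc (suc N)} ¬p0 p1 _ with p 0 | p 1
  ... | false | true = refl
  ... | true  | _    = ⊥-elim (¬p0 _)
  least≡1 p {suc zero} _ _ (s≤s ())

  d-adjacent : ∀ {x y} → T (adj x y) → d G x y ≡ just 1
  d-adjacent {x} {y} xy = least≡1 (λ m → reach G m x y) (x≢y ∘ toWitness) reach₁ (≢⇒2≤ x≢y)
    where
    x≢y : x ≢ y
    x≢y refl = subst T (irrefl x) xy
    reach₁ : T (reach G 1 x y)
    reach₁ = Equivalence.from Bool.T-∨ (inj₂ (any⁺ _ (lose (∈-allFin x) (T-∧⁺ (fromWitness refl , xy)))))

  len-clique : ∀ {s} → IsClique s → ∀ l → T (distinctIn s l) → len G l ≡ just (pred (length l))
  len-clique clique []          _ = refl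
  len-clique clique (x ∷ [])    _ = refl
  len-clique {s} clique (x ∷ y ∷ l) dxyl =
    let sx , sy , x≢y , dyl = distinctIn-∷-∷⁻ {s = s} x y l dxyl in
    cong₂ (_+ᴹ_ G) (d-adjacent (clique sx sy x≢y)) (len-clique clique (y ∷ l) dyl)

  len-arrangement : ∀ {s} → IsClique s → ∀ {k} (g : Vec (Fin n) (suc k)) →
                    T (distinctIn s (V.toList g)) → len G (V.toList g) ≡ just k
  len-arrangement clique g dg =
    trans (len-clique clique (V.toList g) dg) (cong (just ∘ pred) (V.length-toList g))

  distinctIn⇒consecDistinct : ∀ {s} l → T (distinctIn s l) → T (consecDistinct G l)
  distinctIn⇒consecDistinct []          _ = _
  distinctIn⇒consecDistinct (x ∷ [])    _ = _
  distinctIn⇒consecDistinct {s} (x ∷ y ∷ l) dxyl =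
    let _ , _ , x≢y , dyl = distinctIn-∷-∷⁻ {s = s} x y l dxyl in
    T-∧⁺ (fromWitnessFalse x≢y , distinctIn⇒consecDistinct (y ∷ l) dyl)

  hasLength⁺ : ∀ l {ℓ} → len G l ≡ just ℓ → T (hasLength G l ℓ)
  hasLength⁺ l {ℓ} len≡ℓ = subst (λ z → T (eqMℕ G z ℓ)) (sym len≡ℓ) (fromWitness refl)

  hasLength⁻ : ∀ l {ℓ ℓ′} → len G l ≡ just ℓ → T (hasLength G l ℓ′) → ℓ ≡ ℓ′
  hasLength⁻ l {ℓ} {ℓ′} len≡ℓ = toWitness ∘ subst (λ z → T (eqMℕ G z ℓ′)) len≡ℓ

  -- For k = 0 there is no interior index 1 ≤ i < k, so ∂ is the empty sum.
  ∂-arrangement≡0 : ∀ {s} → IsClique s → ∀ k (g : Vec (Fin n) (suc k)) →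
                    T (distinctIn s (V.toList g)) → ∀ y → ∂coeff G k k g y ≡ 0ℤ
  ∂-arrangement≡0 clique zero    g dg y = refl
  ∂-arrangement≡0 clique (suc k) g dg y =
    foldr-+-zeros _ (λ i → if-¬T (¬T-∧ʳ (1 ≤ᵇ toℕ i) (¬T-∧ʳ (toℕ i <ᵇ suc k)
                                                      (¬T-∧ˡ (face-too-short i)))))
                  (L.allFin (2 + k))
    where
    face-too-short : ∀ i → ¬ T (hasLength G (V.toList (V.removeAt g i)) (suc k))
    face-too-short i = <⇒≢ (n<1+n k) ∘ hasLength⁻ (V.toList (V.removeAt g i))
      (len-arrangement clique (V.removeAt g i) (distinctIn-removeAt g i dg))

  Z? : ∀ k → Vec (Fin n) (suc k) → Bool
  Z? k g = isET G k k g ∧ ∂zero G k k g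

  arrangement∈Z : ∀ {s} → IsClique s → ∀ k (g : Vec (Fin n) (suc k)) →
                  T (distinctIn s (V.toList g)) → T (Z? k g)
  arrangement∈Z clique k g dg = T-∧⁺ (isET-g , ∂g≡0)
    where
    isET-g : T (isET G k k g)
    isET-g = T-∧⁺ ( distinctIn⇒consecDistinct (V.toList g) dg
                  , T-∧⁺ ( proj₁ (T-∧⁻ {distinct (V.toList g)} dg)
                         , hasLength⁺ (V.toList g) (len-arrangement clique g dg)))
    ∂g≡0 : T (∂zero G k k g)
    ∂g≡0 = all⁻ _ (All.universal (fromWitness ∘ ∂-arrangement≡0 clique k g dg) (vecs (vertices G) k))

  -- inducedIso G (Δ m) W unfolds definitionally to any (embedsΔ W) (vecs (vertices G) m).
  embedsΔ : ∀ {m} → Vec Bool n → Vec (Fin n) m → Bool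
  embedsΔ {m} W f =
    distinct (V.toList f)
    ∧ all (λ v → V.lookup W v ⇔ᵇ elemF v f) (vertices G)
    ∧ all (λ i → all (λ j → adj (V.lookup f i) (V.lookup f j) ⇔ᵇ not ⌊ i Fin.≟ j ⌋) (L.allFin m))
          (L.allFin m)

  inducedIso-Δ⁻ : ∀ m (W : Vec Bool n) → T (inducedIso G (Δ m) W) →
                  ∃ λ (f : Vec (Fin n) m) →
                    T (distinct (V.toList f))
                    × (∀ v → V.lookup W v ≡ elemF v f)
                    × (∀ i j → adj (V.lookup f i) (V.lookup f j) ≡ not ⌊ i Fin.≟ j ⌋)
  inducedIso-Δ⁻ m W iso =
    let f , f-embeds = satisfied (any⁻ (embedsΔ W) (vecs (vertices G) m) iso)
        df , f-rest  = T-∧⁻ {distinct (V.toList f)} f-embeds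
        W≡f , f-adj  = T-∧⁻ f-rest
    in f , df , (λ v → T-⇔ᵇ⁻ _ _ (All.lookup (all⁺ _ _ W≡f) (∈-allFin v)))
              , (λ i j → T-⇔ᵇ⁻ _ _ (All.lookup (all⁺ _ _ (All.lookup (all⁺ _ _ f-adj) (∈-allFin i)))
                                               (∈-allFin j)))

  inducedIso-Δ⇒clique : ∀ m (W : Vec Bool n) → T (inducedIso G (Δ m) W) →
                        IsClique (V.lookup W) × count (V.lookup W) (vertices G) ≡ m
  inducedIso-Δ⇒clique m W iso with f , df , W≡image , adj≡ ← inducedIso-Δ⁻ m W iso = clique , |W|≡m
    where
    clique : IsClique (V.lookup W)
    clique {u} {v} Wu Wv u≢v
      with i , refl ← elemF⇒lookup {g = f} (subst T (W≡image u) Wu)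
      with j , refl ← elemF⇒lookup {g = f} (subst T (W≡image v) Wv) =
      subst T (sym (adj≡ i j)) (fromWitnessFalse (u≢v ∘ cong (V.lookup f)))
    |W|≡m : count (V.lookup W) (vertices G) ≡ m
    |W|≡m = trans (count-cong W≡image (vertices G)) (count-elemF (allFin-enumerates n) f df)

  _≟ₛ_ : DecidableEquality (Vec Bool n)
  _≟ₛ_ = V.≡-dec Bool._≟_

  clique*[1+k]!≤fibre : ∀ k (W : Vec Bool n) →
    [ inducedIso G (Δ (suc k)) W ] * suc k !
      ≤ count (λ g → Z? k g ∧ ⌊ support g ≟ₛ W ⌋) (vecs (vertices G) (suc k))
  clique*[1+k]!≤fibre k W with T? (inducedIso G (Δ (suc k)) W)
  ... | no ¬iso rewrite []-false ¬iso = z≤n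
  ... | yes iso rewrite []-true iso with clique , |W|≡1+k ← inducedIso-Δ⇒clique (suc k) W iso = begin
    1 * suc k !
      ≡⟨ *-identityˡ _ ⟩
    suc k !
      ≡⟨ count-arrangements (allFin-enumerates n) (suc k) |W|≡1+k ⟨
    count (λ g → distinctIn (V.lookup W) (V.toList g)) (vecs (vertices G) (suc k))
      ≤⟨ count-mono-≤ arrangement∈fibre (vecs (vertices G) (suc k)) ⟩
    count (λ g → Z? k g ∧ ⌊ support g ≟ₛ W ⌋) (vecs (vertices G) (suc k)) ∎
    where
    open ≤-Reasoning
    arrangement∈fibre : ∀ g → T (distinctIn (V.lookup W) (V.toList g)) → T (Z? k g ∧ ⌊ support g ≟ₛ W ⌋)
    arrangement∈fibre g dg =
      T-∧⁺ ( arrangement∈Z clique k g dg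
           , fromWitness (trans (support-arrangement {g = g} |W|≡1+k dg) (V.tabulate∘lookup W)))

  c*[1+k]!≤|Z| : ∀ k → c G (Δ (suc k)) * suc k ! ≤ sizeZ G k
  c*[1+k]!≤|Z| k = begin
    c G (Δ (suc k)) * suc k !
      ≡⟨ cong (_* suc k !) (count≡∑ _ (subsets G)) ⟩
    ∑ (λ W → [ inducedIso G (Δ (suc k)) W ]) (subsets G) * suc k !
      ≡⟨ ∑-distribʳ-* _ (suc k !) (subsets G) ⟨
    ∑ (λ W → [ inducedIso G (Δ (suc k)) W ] * suc k !) (subsets G)
      ≤⟨ ∑-mono-≤ (clique*[1+k]!≤fibre k) (subsets G) ⟩
    ∑ (λ W → count (λ g → Z? k g ∧ ⌊ support g ≟ₛ W ⌋) (vecs (vertices G) (suc k))) (subsets G)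
      ≡⟨ count-by-key (vecs-enumerates Bool-enumerates n) support (Z? k) (vecs (vertices G) (suc k)) ⟨
    sizeZ G k ∎
    where open ≤-Reasoning

m*n≤o⇒m≤o/n : ∀ {m n o} .{{_ : NonZero n}} → m * n ≤ o → m ≤ o / n
m*n≤o⇒m≤o/n {m} {n} {o} m*n≤o = subst (_≤ o / n) (m*n/n≡m m n) (/-monoˡ-≤ n m*n≤o)

lemma3p3 : (G : Graph) (k : ℕ) →
    c G (Δ (suc k)) ≤ (sizeZ G k / (suc k) !) {{(suc k) !≢0}}
lemma3p3 G k = m*n≤o⇒m≤o/n {{suc k !≢0}} (c*[1+k]!≤|Z| G k)
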